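{- For every integer $n\ge 0$, $$\xi_{n,1/q}(2)=(-1)^nq^n\,\xi_{n,q}(-1).$$
   Context: Let $p$ be an odd prime, $\mathbb{C}_p$ the completion of an algebraic closure of $\mathbb{Q}_p$, and $q\in\mathbb{C}_p$ with $|1-q|_p<1$ (then also $|1-q^{ -1}|_p<1$). For $Q\in\{q,q^{ -1}\}$ put $[x]_Q=\frac{1-Q^x}{1-Q}$. The $Q$-Euler numbers $\xi_{n,Q}$ are defined by $\xi_{0,Q}=1$ and, for $n\ge 1$, $Q\sum_{l=0}^{n}\binom{n}{l}Q^l\xi_{l,Q}+\xi_{n,Q}=0$. The $Q$-Euler polynomials are $\xi_{n,Q}(x)=\sum_{l=0}^{n}\binom{n}{l}[x]_Q^{\,n-l}Q^{lx}\xi_{l,Q}$. Thus $\xi_{n,1/q}(x)$ denotes these objects with $q$ replaced by $q^{ -1}$. -}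

module Defs where

open import Level using (Level)
open import Algebra.Bundles using (CommutativeRing)
open import Data.Nat using (ℕ; zero; suc; _∸_)
open import Data.Nat.Combinatorics using (_C_)
open import Data.Integer using (ℤ; +_; -[1+_])
import Data.Integer as ℤ

module QEuler {c ℓ : Level} (R : CommutativeRing c ℓ) where
  open CommutativeRing R

  pow : Carrier → ℕ → Carrier
  pow x zero    = 1#
  pow x (suc n) = x * pow x n

  nat : ℕ → Carrier
  nat zero    = 0#
  nat (suc n) = 1# + nat n

  sumTo : ℕ → (ℕ → Carrier) → Carrier
  sumTo zero    f = f 0
  sumTo (suc n) f = sumTo n f + f (suc n)

  -- Q ^ x for x : ℤ, where Qi is the inverse of Q
  zpow : (Q Qi : Carrier) → ℤ → Carrier
  zpow Q Qi (+ n)      = pow Q n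
  zpow Q Qi -[1+ n ]   = pow Qi (suc n)

  -- [x]_Q = (1 - Q^x)/(1 - Q), written as the Laurent polynomial it equals:
  --   [m]_Q  = 1 + Q + ... + Q^(m-1)            (m ≥ 0)
  --   [-m]_Q = -(Q^(-1) + Q^(-2) + ... + Q^(-m)) (m ≥ 1)
  geomSum : Carrier → ℕ → Carrier
  geomSum Q zero    = 0#
  geomSum Q (suc m) = geomSum Q m + pow Q m

  qint : (Q Qi : Carrier) → ℤ → Carrier
  qint Q Qi (+ m)    = geomSum Q m
  qint Q Qi -[1+ m ] = - (Qi * geomSum Qi (suc m))

  record IsQEuler (Q : Carrier) (e : ℕ → Carrier) : Set (c Level.⊔ ℓ) where
    field
      init : e 0 ≈ 1#
      step : ∀ n → Q * sumTo (suc n) (λ l → nat (suc n C l) * (pow Q l * e l))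
                     + e (suc n) ≈ 0#

  qEulerPoly : (Q Qi : Carrier) → (ℕ → Carrier) → ℕ → ℤ → Carrier
  qEulerPoly Q Qi e n x =
    sumTo n (λ l → nat (n C l) * (pow (qint Q Qi x) (n ∸ l)
                    * (zpow Q Qi (+ l ℤ.* x) * e l)))

-- Umbrally, write (a + b ξ)ⁿ for the expansion Σ C(n,l) aⁿ⁻ˡ bˡ ξ_l of a sequence ξ.
-- Then ξ_{n,Q}(x) = ([x]_Q + Q^x ξ)ⁿ and the recursion of the Q-Euler numbers reads
-- Q (1 + Q ξ)ⁿ + ξₙ = 0 for n ≥ 1.  Substituting ξ ↦ −q − q² ξ turns this recursion for q
-- into the one for q⁻¹.  The recursion determines its solution, since it fixes
-- (1 + Q^{n+2}) ξ_{n+1} and 1 + q^{n+2}, hence 1 + q^{-(n+2)}, is a non-zero-divisor; so the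
-- q⁻¹-Euler numbers are (−q − q² ξ)ⁿ with ξ the q-Euler numbers.  Hence
--   ξ_{n,1/q}(2) = (1 + q⁻¹ + q⁻² (−q − q² ξ))ⁿ = (1 − ξ)ⁿ = (−1)ⁿ qⁿ (−q⁻¹ + q⁻¹ ξ)ⁿ,
-- and the last expression is (−1)ⁿ qⁿ ξ_{n,q}(−1).
module Submission where

open import Defs
open import Level using (Level)
open import Algebra.Bundles using (CommutativeRing)
open import Data.Nat using (ℕ; suc)
open import Data.Integer using (+_; -[1+_])
open import Data.Nat.Base as ℕ using (zero; _≤_; z≤n; _∸_)
import Data.Nat.Properties as ℕ
open import Data.Nat.Combinatorics
  using (_C_; nCk+nC[k+1]≡[n+1]C[k+1]; nCn≡1; nCk≡nC[n∸k]; k>n⇒nCk≡0)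
import Data.Integer as ℤ
import Data.Integer.Properties as ℤ
open import Data.Sum using (inj₁; inj₂)
open import Function using (_∘_)
open import Relation.Binary.PropositionalEquality as ≡ using (_≡_)

nC0≡1 : ∀ n → n C 0 ≡ 1
nC0≡1 n = ≡.trans (nCk≡nC[n∸k] {0} {n} z≤n) (nCn≡1 n)

module QEulerProperties {c ℓ : Level} (R : CommutativeRing c ℓ) where
  open CommutativeRing R
  open QEuler R
  open import Algebra.Properties.CommutativeSemiring.Exp commutativeSemiring
    using (_^_; ^-congˡ; ^-distrib-*; ^-assocʳ)
  open import Algebra.Properties.Monoid.Mult +-monoid using (_×_; ×-homo-+)
  open import Algebra.Properties.Ring ring using (-‿distribˡ-*; -‿distribʳ-*; -1*x≈-x)
  open import Algebra.Properties.Group +-group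
    using (⁻¹-involutive; inverseʳ-unique; x∙y⁻¹≈ε⇒x≈y)
  open import Algebra.Solver.Ring.NaturalCoefficients.Default commutativeSemiring
  open import Relation.Binary.Reasoning.Setoid setoid

  NonZeroDivisor : Carrier → Set (c Level.⊔ ℓ)
  NonZeroDivisor a = ∀ x → a * x ≈ 0# → x ≈ 0#

  nat≡× : ∀ n → nat n ≡ n × 1#
  nat≡× zero    = ≡.refl
  nat≡× (suc n) = ≡.cong (λ m → 1# + m) (nat≡× n)

  nat-+ : ∀ m n → nat (m ℕ.+ n) ≈ nat m + nat n
  nat-+ m n rewrite nat≡× (m ℕ.+ n) | nat≡× m | nat≡× n = ×-homo-+ 1# m n

  ≡1⇒nat≈1# : ∀ {n} → n ≡ 1 → nat n ≈ 1#
  ≡1⇒nat≈1# ≡.refl = +-identityʳ 1#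

  pow≡^ : ∀ x n → pow x n ≡ x ^ n
  pow≡^ x zero    = ≡.refl
  pow≡^ x (suc n) = ≡.cong (x *_) (pow≡^ x n)

  pow-distrib-* : ∀ x y n → pow (x * y) n ≈ pow x n * pow y n
  pow-distrib-* x y n rewrite pow≡^ (x * y) n | pow≡^ x n | pow≡^ y n = ^-distrib-* x y n

  pow-assocʳ : ∀ x m n → pow (pow x m) n ≈ pow x (m ℕ.* n)
  pow-assocʳ x m n rewrite pow≡^ (pow x m) n | pow≡^ x m | pow≡^ x (m ℕ.* n) = ^-assocʳ x m n

  pow-1# : ∀ n → pow 1# n ≈ 1#
  pow-1# zero    = refl
  pow-1# (suc n) = trans (*-identityˡ _) (pow-1# n)

  pow-congˡ : ∀ n {x y} → x ≈ y → pow x n ≈ pow y n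
  pow-congˡ n {x} {y} x≈y rewrite pow≡^ x n | pow≡^ y n = ^-congˡ n x≈y

  pow-inverse : ∀ {x y} n → x * y ≈ 1# → pow x n * pow y n ≈ 1#
  pow-inverse {x} {y} n xy≈1 =
    trans (sym (pow-distrib-* x y n)) (trans (pow-congˡ n xy≈1) (pow-1# n))

  sumTo-cong-≤ : ∀ n {f g : ℕ → Carrier} → (∀ l → l ≤ n → f l ≈ g l) → sumTo n f ≈ sumTo n g
  sumTo-cong-≤ zero    f≈g = f≈g 0 z≤n
  sumTo-cong-≤ (suc n) f≈g =
    +-cong (sumTo-cong-≤ n (λ l l≤n → f≈g l (ℕ.m≤n⇒m≤1+n l≤n))) (f≈g (suc n) ℕ.≤-refl)

  sumTo-cong : ∀ n {f g : ℕ → Carrier} → (∀ l → f l ≈ g l) → sumTo n f ≈ sumTo n g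
  sumTo-cong n f≈g = sumTo-cong-≤ n (λ l _ → f≈g l)

  sumTo-distrib-+ : ∀ n (f g : ℕ → Carrier) → sumTo n (λ l → f l + g l) ≈ sumTo n f + sumTo n g
  sumTo-distrib-+ zero    f g = refl
  sumTo-distrib-+ (suc n) f g = trans (+-congʳ (sumTo-distrib-+ n f g))
    (solve 4 (λ a b x y → (a :+ b) :+ (x :+ y) := (a :+ x) :+ (b :+ y)) refl _ _ _ _)

  *-distribˡ-sumTo : ∀ n k (f : ℕ → Carrier) → k * sumTo n f ≈ sumTo n (λ l → k * f l)
  *-distribˡ-sumTo zero    k f = refl
  *-distribˡ-sumTo (suc n) k f = trans (distribˡ _ _ _) (+-congʳ (*-distribˡ-sumTo n k f))

  sumTo-suc : ∀ n (f : ℕ → Carrier) → sumTo (suc n) f ≈ f 0 + sumTo n (f ∘ suc)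
  sumTo-suc zero    f = refl
  sumTo-suc (suc n) f = trans (+-congʳ (sumTo-suc n f)) (+-assoc _ _ _)

  binomialSum : ℕ → (ℕ → ℕ → Carrier) → Carrier
  binomialSum n f = sumTo n (λ l → nat (n C l) * f (n ∸ l) l)

  binomialSum-cong : ∀ n {f g : ℕ → ℕ → Carrier} → (∀ i j → f i j ≈ g i j) →
                     binomialSum n f ≈ binomialSum n g
  binomialSum-cong n f≈g = sumTo-cong n (λ l → *-congˡ (f≈g _ l))

  *-distribˡ-binomialSum : ∀ n k (f : ℕ → ℕ → Carrier) →
                           k * binomialSum n f ≈ binomialSum n (λ i j → k * f i j)
  *-distribˡ-binomialSum n k f = trans (*-distribˡ-sumTo n k _) (sumTo-cong n (λ l →
    solve 3 (λ k m x → k :* (m :* x) := m :* (k :* x)) refl _ _ _))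

  binomialSum-suc : ∀ n (f : ℕ → ℕ → Carrier) →
    binomialSum (suc n) f ≈ binomialSum n (λ i j → f (suc i) j) + binomialSum n (λ i j → f i (suc j))
  binomialSum-suc n f = begin
      binomialSum (suc n) f
    ≈⟨ sumTo-suc n g ⟩
      g 0 + sumTo n (g ∘ suc)
    ≈⟨ +-congˡ (trans (sumTo-cong n pascal) (sumTo-distrib-+ n shifted unshifted)) ⟩
      g 0 + (sumTo n shifted + sumTo n unshifted)
    ≈⟨ sym (+-assoc _ _ _) ⟩
      (g 0 + sumTo n shifted) + sumTo n unshifted
    ≈⟨ +-congʳ lowerPart ⟩
      binomialSum n (λ i j → f (suc i) j) + binomialSum n (λ i j → f i (suc j))
    ∎
    where
    g h shifted unshifted : ℕ → Carrier
    g l         = nat (suc n C l) * f (suc n ∸ l) l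
    h l         = nat (n C l) * f (suc n ∸ l) l
    shifted k   = nat (n C suc k) * f (n ∸ k) (suc k)
    unshifted k = nat (n C k) * f (n ∸ k) (suc k)

    pascal : ∀ k → g (suc k) ≈ shifted k + unshifted k
    pascal k = begin
        g (suc k)
      ≈⟨ *-congʳ (reflexive (≡.cong nat (≡.sym (nCk+nC[k+1]≡[n+1]C[k+1] n k)))) ⟩
        nat (n C k ℕ.+ n C suc k) * f (n ∸ k) (suc k)
      ≈⟨ *-congʳ (trans (nat-+ (n C k) (n C suc k)) (+-comm _ _)) ⟩
        (nat (n C suc k) + nat (n C k)) * f (n ∸ k) (suc k)
      ≈⟨ distribʳ _ _ _ ⟩
        shifted k + unshifted k
      ∎

    lowerPart : g 0 + sumTo n shifted ≈ binomialSum n (λ i j → f (suc i) j)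
    lowerPart = begin
        g 0 + sumTo n shifted
      ≈⟨ +-congʳ (*-congʳ (trans (≡1⇒nat≈1# (nC0≡1 (suc n))) (sym (≡1⇒nat≈1# (nC0≡1 n))))) ⟩
        h 0 + sumTo n (h ∘ suc)
      ≈⟨ sym (sumTo-suc n h) ⟩
        sumTo n h + h (suc n)
      ≈⟨ +-congˡ (trans (*-congʳ (reflexive (≡.cong nat (k>n⇒nCk≡0 (ℕ.n<1+n n))))) (zeroˡ _)) ⟩
        sumTo n h + 0#
      ≈⟨ +-identityʳ _ ⟩
        sumTo n h
      ≈⟨ sumTo-cong-≤ n (λ l l≤n → *-congˡ (reflexive (≡.cong (λ i → f i l) (ℕ.+-∸-assoc 1 l≤n)))) ⟩
        binomialSum n (λ i j → f (suc i) j)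
      ∎

  -- umbral a b ξ n is (a + b ξ)ⁿ with ξˡ read as ξ l: multiplying by ξ shifts the sequence.
  umbral : Carrier → Carrier → (ℕ → Carrier) → ℕ → Carrier
  umbral a b ξ zero    = ξ 0
  umbral a b ξ (suc n) = a * umbral a b ξ n + b * umbral a b (ξ ∘ suc) n

  umbral-cong : ∀ n {a a′ b b′} {ξ ξ′ : ℕ → Carrier} → a ≈ a′ → b ≈ b′ → (∀ m → ξ m ≈ ξ′ m) →
                umbral a b ξ n ≈ umbral a′ b′ ξ′ n
  umbral-cong zero    a≈a′ b≈b′ ξ≈ξ′ = ξ≈ξ′ 0
  umbral-cong (suc n) a≈a′ b≈b′ ξ≈ξ′ =
    +-cong (*-cong a≈a′ (umbral-cong n a≈a′ b≈b′ ξ≈ξ′))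
           (*-cong b≈b′ (umbral-cong n a≈a′ b≈b′ (ξ≈ξ′ ∘ suc)))

  umbral-linear : ∀ n a b (ξ ζ : ℕ → Carrier) x y →
    umbral a b (λ m → x * ξ m + y * ζ m) n ≈ x * umbral a b ξ n + y * umbral a b ζ n
  umbral-linear zero    a b ξ ζ x y = refl
  umbral-linear (suc n) a b ξ ζ x y =
    trans (+-cong (*-congˡ (umbral-linear n a b ξ ζ x y))
                  (*-congˡ (umbral-linear n a b (ξ ∘ suc) (ζ ∘ suc) x y)))
          (solve 8 (λ a b x y p q r s →
              a :* (x :* p :+ y :* q) :+ b :* (x :* r :+ y :* s)
           := x :* (a :* p :+ b :* r) :+ y :* (a :* q :+ b :* s)) refl _ _ _ _ _ _ _ _)

  umbral-∘ : ∀ n a b a′ b′ (ξ : ℕ → Carrier) →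
    umbral a b (umbral a′ b′ ξ) n ≈ umbral (a + b * a′) (b * b′) ξ n
  umbral-∘ zero    a b a′ b′ ξ = refl
  umbral-∘ (suc n) a b a′ b′ ξ = begin
      a * umbral a b η n + b * umbral a b (η ∘ suc) n
    ≈⟨ +-congˡ (*-congˡ (umbral-linear n a b η (umbral a′ b′ (ξ ∘ suc)) a′ b′)) ⟩
      a * umbral a b η n + b * (a′ * umbral a b η n + b′ * umbral a b (umbral a′ b′ (ξ ∘ suc)) n)
    ≈⟨ +-cong (*-congˡ IH) (*-congˡ (+-cong (*-congˡ IH) (*-congˡ (umbral-∘ n a b a′ b′ (ξ ∘ suc))))) ⟩
      a * u + b * (a′ * u + b′ * v)
    ≈⟨ solve 6 (λ a b a′ b′ u v → a :* u :+ b :* (a′ :* u :+ b′ :* v)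
                               := (a :+ b :* a′) :* u :+ (b :* b′) :* v) refl a b a′ b′ u v ⟩
      (a + b * a′) * u + (b * b′) * v
    ∎
    where
    η = umbral a′ b′ ξ
    IH = umbral-∘ n a b a′ b′ ξ
    u = umbral (a + b * a′) (b * b′) ξ n
    v = umbral (a + b * a′) (b * b′) (ξ ∘ suc) n

  umbral-scale : ∀ n k a b (ξ : ℕ → Carrier) → umbral (k * a) (k * b) ξ n ≈ pow k n * umbral a b ξ n
  umbral-scale zero    k a b ξ = sym (*-identityˡ _)
  umbral-scale (suc n) k a b ξ =
    trans (+-cong (*-congˡ (umbral-scale n k a b ξ)) (*-congˡ (umbral-scale n k a b (ξ ∘ suc))))
          (solve 6 (λ k a b p x y → (k :* a) :* (p :* x) :+ (k :* b) :* (p :* y)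
                                 := (k :* p) :* (a :* x :+ b :* y)) refl _ _ _ _ _ _)

  umbral-0# : ∀ n b (ξ : ℕ → Carrier) → umbral 0# b ξ n ≈ pow b n * ξ n
  umbral-0# zero    b ξ = sym (*-identityˡ _)
  umbral-0# (suc n) b ξ =
    trans (+-cong (*-congˡ (umbral-0# n b ξ)) (*-congˡ (umbral-0# n b (ξ ∘ suc))))
          (solve 5 (λ b p x q y → con 0 :* (p :* x) :+ b :* (q :* y) := (b :* q) :* y) refl _ _ _ _ _)

  binomialSum≈umbral : ∀ n a b (ξ : ℕ → Carrier) →
    binomialSum n (λ i j → pow a i * (pow b j * ξ j)) ≈ umbral a b ξ n
  binomialSum≈umbral zero    a b ξ =
    trans (*-cong (≡1⇒nat≈1# (nC0≡1 0)) (trans (*-identityˡ _) (*-identityˡ _))) (*-identityˡ _)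
  binomialSum≈umbral (suc n) a b ξ = begin
      binomialSum (suc n) (term ξ)
    ≈⟨ binomialSum-suc n (term ξ) ⟩
      binomialSum n (λ i j → term ξ (suc i) j) + binomialSum n (λ i j → term ξ i (suc j))
    ≈⟨ +-cong (binomialSum-cong n (λ i j → *-assoc a (pow a i) (pow b j * ξ j)))
              (binomialSum-cong n (λ i j → solve 4 (λ p b q x → p :* ((b :* q) :* x) := b :* (p :* (q :* x)))
                                                   refl (pow a i) b (pow b j) (ξ (suc j)))) ⟩
      binomialSum n (λ i j → a * term ξ i j) + binomialSum n (λ i j → b * term (ξ ∘ suc) i j)
    ≈⟨ sym (+-cong (*-distribˡ-binomialSum n a (term ξ)) (*-distribˡ-binomialSum n b (term (ξ ∘ suc)))) ⟩
      a * binomialSum n (term ξ) + b * binomialSum n (term (ξ ∘ suc))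
    ≈⟨ +-cong (*-congˡ (binomialSum≈umbral n a b ξ)) (*-congˡ (binomialSum≈umbral n a b (ξ ∘ suc))) ⟩
      umbral a b ξ (suc n)
    ∎
    where
    term : (ℕ → Carrier) → ℕ → ℕ → Carrier
    term ζ i j = pow a i * (pow b j * ζ j)

  *-inverse-cancelˡ : ∀ {y x} z → y * x ≈ 1# → y * (x * z) ≈ z
  *-inverse-cancelˡ z yx≈1 = trans (sym (*-assoc _ _ _)) (trans (*-congʳ yx≈1) (*-identityˡ z))

  inverse-nonZeroDivisor : ∀ {Q Qi} n → Q * Qi ≈ 1# →
    NonZeroDivisor (1# + pow Q n) → NonZeroDivisor (1# + pow Qi n)
  inverse-nonZeroDivisor {Q} {Qi} n QQi≈1 regular x [1+Qiⁿ]x≈0 = regular x (begin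
      (1# + pow Q n) * x
    ≈⟨ *-congʳ (+-cong (sym (pow-inverse n QQi≈1)) (sym (*-identityʳ _))) ⟩
      (pow Q n * pow Qi n + pow Q n * 1#) * x
    ≈⟨ solve 4 (λ a b o x → (a :* b :+ a :* o) :* x := a :* ((o :+ b) :* x)) refl _ _ 1# x ⟩
      pow Q n * ((1# + pow Qi n) * x)
    ≈⟨ *-congˡ [1+Qiⁿ]x≈0 ⟩
      pow Q n * 0#
    ≈⟨ zeroʳ _ ⟩
      0#
    ∎)

  qEulerSum≈umbral : ∀ n Q (ξ : ℕ → Carrier) →
    sumTo n (λ l → nat (n C l) * (pow Q l * ξ l)) ≈ umbral 1# Q ξ n
  qEulerSum≈umbral n Q ξ =
    trans (binomialSum-cong n {f = λ _ j → pow Q j * ξ j}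
                              (λ i j → sym (trans (*-congʳ (pow-1# i)) (*-identityˡ _))))
          (binomialSum≈umbral n 1# Q ξ)

  IsQEuler-umbral : ∀ {Q ξ} → IsQEuler Q ξ → ∀ n → Q * umbral 1# Q ξ (suc n) + ξ (suc n) ≈ 0#
  IsQEuler-umbral {Q} {ξ} isQE n =
    trans (+-congʳ (*-congˡ (sym (qEulerSum≈umbral (suc n) Q ξ)))) (IsQEuler.step isQE n)

  IsQEuler-solve : ∀ {Q ξ} → IsQEuler Q ξ → ∀ n →
    (1# + pow Q (suc (suc n))) * ξ (suc n) ≈ - (Q * sumTo n (λ l → nat (suc n C l) * (pow Q l * ξ l)))
  IsQEuler-solve {Q} {ξ} isQE n = inverseʳ-unique _ _ (begin
      Q * S + (1# + Q * P) * x
    ≈⟨ solve 5 (λ Q S P x o → Q :* S :+ (o :+ Q :* P) :* x := Q :* (S :+ P :* x) :+ o :* x)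
             refl Q S P x 1# ⟩
      Q * (S + P * x) + 1# * x
    ≈⟨ +-cong (*-congˡ (+-congˡ (sym lastTerm))) (*-identityˡ x) ⟩
      Q * sumTo (suc n) (λ l → nat (suc n C l) * (pow Q l * ξ l)) + x
    ≈⟨ IsQEuler.step isQE n ⟩
      0#
    ∎)
    where
    S = sumTo n (λ l → nat (suc n C l) * (pow Q l * ξ l))
    P = pow Q (suc n)
    x = ξ (suc n)
    lastTerm : nat (suc n C suc n) * (P * x) ≈ P * x
    lastTerm = trans (*-congʳ (≡1⇒nat≈1# (nCn≡1 (suc n)))) (*-identityˡ _)

  qEuler-unique : ∀ {Q ξ ζ} → (∀ k → NonZeroDivisor (1# + pow Q (suc k))) →
                  IsQEuler Q ξ → IsQEuler Q ζ → ∀ n → ξ n ≈ ζ n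
  qEuler-unique {Q} {ξ} {ζ} regular isξ isζ n = agreeUpTo n n ℕ.≤-refl
    where
    agreeUpTo : ∀ n l → l ≤ n → ξ l ≈ ζ l
    agreeUpTo zero    .0 z≤n  = trans (IsQEuler.init isξ) (sym (IsQEuler.init isζ))
    agreeUpTo (suc n) l  l≤1+n with ℕ.m≤n⇒m<n∨m≡n l≤1+n
    ... | inj₁ l<1+n  = agreeUpTo n l (ℕ.≤-pred l<1+n)
    ... | inj₂ ≡.refl = x∙y⁻¹≈ε⇒x≈y _ _ (regular (suc n) _ (begin
        (1# + K) * (ξ (suc n) - ζ (suc n))
      ≈⟨ trans (distribˡ _ _ _) (+-congˡ (sym (-‿distribʳ-* _ _))) ⟩
        (1# + K) * ξ (suc n) - (1# + K) * ζ (suc n)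
      ≈⟨ +-cong (IsQEuler-solve isξ n) (-‿cong (IsQEuler-solve isζ n)) ⟩
        - (Q * sum ξ) - - (Q * sum ζ)
      ≈⟨ +-congˡ (-‿cong (-‿cong (*-congˡ (sumTo-cong-≤ n earlierTermsAgree)))) ⟩
        - (Q * sum ξ) - - (Q * sum ξ)
      ≈⟨ -‿inverseʳ _ ⟩
        0#
      ∎))
      where
      K = pow Q (suc (suc n))
      sum : (ℕ → Carrier) → Carrier
      sum η = sumTo n (λ l → nat (suc n C l) * (pow Q l * η l))
      earlierTermsAgree : ∀ l → l ≤ n → nat (suc n C l) * (pow Q l * ζ l) ≈ nat (suc n C l) * (pow Q l * ξ l)
      earlierTermsAgree l l≤n = *-congˡ (*-congˡ (sym (agreeUpTo n l l≤n)))

  -- Substituting ξ ↦ −Q − Q² ξ turns 1 + Q⁻¹ ξ into −Q ξ and ξ into −Q (1 + Q ξ).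
  qEuler-inverse : ∀ {Q Qi ξ} → Q * Qi ≈ 1# → IsQEuler Q ξ → IsQEuler Qi (umbral (- Q) (- (Q * Q)) ξ)
  qEuler-inverse {Q} {Qi} {ξ} QQi≈1 isQE = record { init = IsQEuler.init isQE ; step = step }
    where
    η = umbral (- Q) (- (Q * Q)) ξ

    QiQ≈1 : Qi * Q ≈ 1#
    QiQ≈1 = trans (*-comm Qi Q) QQi≈1

    1+Qiη≈-Qξ : ∀ m → umbral 1# Qi η m ≈ pow (- Q) m * ξ m
    1+Qiη≈-Qξ m = begin
        umbral 1# Qi η m
      ≈⟨ umbral-∘ m 1# Qi (- Q) (- (Q * Q)) ξ ⟩
        umbral (1# + Qi * - Q) (Qi * - (Q * Q)) ξ m
      ≈⟨ umbral-cong m constant≈0 linear≈-Q (λ _ → refl) ⟩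
        umbral 0# (- Q) ξ m
      ≈⟨ umbral-0# m (- Q) ξ ⟩
        pow (- Q) m * ξ m
      ∎
      where
      constant≈0 : 1# + Qi * - Q ≈ 0#
      constant≈0 = trans (+-congˡ (trans (sym (-‿distribʳ-* Qi Q)) (-‿cong QiQ≈1))) (-‿inverseʳ 1#)
      linear≈-Q : Qi * - (Q * Q) ≈ - Q
      linear≈-Q = trans (sym (-‿distribʳ-* Qi (Q * Q))) (-‿cong (*-inverse-cancelˡ Q QiQ≈1))

    η≈-Q[1+Qξ] : ∀ m → η m ≈ pow (- Q) m * umbral 1# Q ξ m
    η≈-Q[1+Qξ] m = trans (umbral-cong m (sym (*-identityʳ _)) (-‿distribˡ-* Q Q) (λ _ → refl))
                         (umbral-scale m (- Q) 1# Q ξ)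

    step : ∀ n → Qi * sumTo (suc n) (λ l → nat (suc n C l) * (pow Qi l * η l)) + η (suc n) ≈ 0#
    step n = begin
        Qi * sumTo (suc n) (λ l → nat (suc n C l) * (pow Qi l * η l)) + η (suc n)
      ≈⟨ +-cong (*-congˡ (trans (qEulerSum≈umbral (suc n) Qi η) (1+Qiη≈-Qξ (suc n))))
                (η≈-Q[1+Qξ] (suc n)) ⟩
        Qi * (P * x) + P * U
      ≈⟨ +-congˡ (*-congˡ (sym (*-inverse-cancelˡ U QiQ≈1))) ⟩
        Qi * (P * x) + P * (Qi * (Q * U))
      ≈⟨ solve 5 (λ Qi P x Q U → Qi :* (P :* x) :+ P :* (Qi :* (Q :* U)) := P :* (Qi :* (Q :* U :+ x)))
               refl Qi P x Q U ⟩
        P * (Qi * (Q * U + x))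
      ≈⟨ *-congˡ (*-congˡ (IsQEuler-umbral isQE n)) ⟩
        P * (Qi * 0#)
      ≈⟨ trans (*-congˡ (zeroʳ Qi)) (zeroʳ P) ⟩
        0#
      ∎
      where
      P = pow (- Q) (suc n)
      U = umbral 1# Q ξ (suc n)
      x = ξ (suc n)

  zpow-*ˡ : ∀ Q Qi l x → zpow Q Qi (+ l ℤ.* x) ≈ pow (zpow Q Qi x) l
  zpow-*ˡ Q Qi l       (+ m)    = trans (reflexive (≡.cong (zpow Q Qi) (≡.sym (ℤ.pos-* l m))))
    (sym (trans (pow-assocʳ Q m l) (reflexive (≡.cong (pow Q) (ℕ.*-comm m l)))))
  zpow-*ˡ Q Qi zero    -[1+ m ] = refl
  zpow-*ˡ Q Qi (suc l) -[1+ m ] =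
    sym (trans (pow-assocʳ Qi (suc m) (suc l)) (reflexive (≡.cong (pow Qi) (ℕ.*-comm (suc m) (suc l)))))

  qEulerPoly≈umbral : ∀ Q Qi (ξ : ℕ → Carrier) n x →
    qEulerPoly Q Qi ξ n x ≈ umbral (qint Q Qi x) (zpow Q Qi x) ξ n
  qEulerPoly≈umbral Q Qi ξ n x =
    trans (binomialSum-cong n {f = λ i l → pow (qint Q Qi x) i * (zpow Q Qi (+ l ℤ.* x) * ξ l)}
                              (λ i l → *-congˡ (*-congʳ (zpow-*ˡ Q Qi l x))))
          (binomialSum≈umbral n (qint Q Qi x) (zpow Q Qi x) ξ)

  qEulerPoly-2 : ∀ Q Qi (ξ : ℕ → Carrier) n → qEulerPoly Q Qi ξ n (+ 2) ≈ umbral (1# + Q) (Q * Q) ξ n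
  qEulerPoly-2 Q Qi ξ n = trans (qEulerPoly≈umbral Q Qi ξ n (+ 2))
    (umbral-cong n (+-cong (+-identityˡ 1#) (*-identityʳ Q)) (*-congˡ (*-identityʳ Q)) (λ _ → refl))

  qEulerPoly-−1 : ∀ Q Qi (ξ : ℕ → Carrier) n → qEulerPoly Q Qi ξ n -[1+ 0 ] ≈ umbral (- Qi) Qi ξ n
  qEulerPoly-−1 Q Qi ξ n = trans (qEulerPoly≈umbral Q Qi ξ n -[1+ 0 ])
    (umbral-cong n (-‿cong (trans (*-congˡ (+-identityˡ 1#)) (*-identityʳ Qi))) (*-identityʳ Qi) (λ _ → refl))

  [1+Qi+Qi²[-Q-Q²ξ]]ⁿ≈[1-ξ]ⁿ : ∀ {Q Qi} → Q * Qi ≈ 1# → ∀ n (ξ : ℕ → Carrier) →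
    umbral (1# + Qi) (Qi * Qi) (umbral (- Q) (- (Q * Q)) ξ) n ≈ umbral 1# (- 1#) ξ n
  [1+Qi+Qi²[-Q-Q²ξ]]ⁿ≈[1-ξ]ⁿ {Q} {Qi} QQi≈1 n ξ =
    trans (umbral-∘ n (1# + Qi) (Qi * Qi) (- Q) (- (Q * Q)) ξ)
          (umbral-cong n constant≈1 linear≈-1 (λ _ → refl))
    where
    QiQ≈1 : Qi * Q ≈ 1#
    QiQ≈1 = trans (*-comm Qi Q) QQi≈1
    constant≈1 : (1# + Qi) + (Qi * Qi) * - Q ≈ 1#
    constant≈1 = begin
        (1# + Qi) + (Qi * Qi) * - Q
      ≈⟨ +-congˡ (trans (sym (-‿distribʳ-* _ Q)) (-‿cong (trans (*-assoc Qi Qi Q) (*-congˡ QiQ≈1)))) ⟩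
        (1# + Qi) - Qi * 1#
      ≈⟨ trans (+-assoc 1# Qi _) (+-congˡ (trans (+-congˡ (-‿cong (*-identityʳ Qi))) (-‿inverseʳ Qi))) ⟩
        1# + 0#
      ≈⟨ +-identityʳ 1# ⟩
        1#
      ∎
    linear≈-1 : (Qi * Qi) * - (Q * Q) ≈ - 1#
    linear≈-1 = begin
        (Qi * Qi) * - (Q * Q)
      ≈⟨ sym (-‿distribʳ-* _ _) ⟩
        - ((Qi * Qi) * (Q * Q))
      ≈⟨ -‿cong (solve 2 (λ a b → (a :* a) :* (b :* b) := (a :* b) :* (a :* b)) refl Qi Q) ⟩
        - ((Qi * Q) * (Qi * Q))
      ≈⟨ -‿cong (trans (*-cong QiQ≈1 QiQ≈1) (*-identityˡ 1#)) ⟩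
        - 1#
      ∎

  [-1]ⁿQⁿ[-Qi+Qiξ]ⁿ≈[1-ξ]ⁿ : ∀ {Q Qi} → Q * Qi ≈ 1# → ∀ n (ξ : ℕ → Carrier) →
    pow (- 1#) n * (pow Q n * umbral (- Qi) Qi ξ n) ≈ umbral 1# (- 1#) ξ n
  [-1]ⁿQⁿ[-Qi+Qiξ]ⁿ≈[1-ξ]ⁿ {Q} {Qi} QQi≈1 n ξ = begin
      pow (- 1#) n * (pow Q n * umbral (- Qi) Qi ξ n)
    ≈⟨ *-congˡ (sym (umbral-scale n Q (- Qi) Qi ξ)) ⟩
      pow (- 1#) n * umbral (Q * - Qi) (Q * Qi) ξ n
    ≈⟨ sym (umbral-scale n (- 1#) (Q * - Qi) (Q * Qi) ξ) ⟩
      umbral (- 1# * (Q * - Qi)) (- 1# * (Q * Qi)) ξ n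
    ≈⟨ umbral-cong n constant≈1 linear≈-1 (λ _ → refl) ⟩
      umbral 1# (- 1#) ξ n
    ∎
    where
    constant≈1 : - 1# * (Q * - Qi) ≈ 1#
    constant≈1 = begin
        - 1# * (Q * - Qi)
      ≈⟨ -1*x≈-x _ ⟩
        - (Q * - Qi)
      ≈⟨ -‿cong (sym (-‿distribʳ-* Q Qi)) ⟩
        - - (Q * Qi)
      ≈⟨ ⁻¹-involutive _ ⟩
        Q * Qi
      ≈⟨ QQi≈1 ⟩
        1#
      ∎
    linear≈-1 : - 1# * (Q * Qi) ≈ - 1#
    linear≈-1 = trans (*-congˡ QQi≈1) (*-identityʳ _)

corollary4 : {c ℓ : Level} (R : CommutativeRing c ℓ) →
    let open CommutativeRing R
        open QEuler R
    in (q qi : Carrier) → q * qi ≈ 1# →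
       (∀ k x → (1# + pow q (suc k)) * x ≈ 0# → x ≈ 0#) →
       (e e′ : ℕ → Carrier) → IsQEuler q e → IsQEuler qi e′ →
       ∀ n → qEulerPoly qi q e′ n (+ 2)
             ≈ pow (- 1#) n * (pow q n * qEulerPoly q qi e n -[1+ 0 ])
corollary4 R q qi qqi≈1 regular e e′ isE isE′ n = begin
    qEulerPoly qi q e′ n (+ 2)
  ≈⟨ qEulerPoly-2 qi q e′ n ⟩
    umbral (1# + qi) (qi * qi) e′ n
  ≈⟨ umbral-cong n refl refl (qEuler-unique regularᵢ isE′ (qEuler-inverse qqi≈1 isE)) ⟩
    umbral (1# + qi) (qi * qi) (umbral (- q) (- (q * q)) e) n
  ≈⟨ [1+Qi+Qi²[-Q-Q²ξ]]ⁿ≈[1-ξ]ⁿ qqi≈1 n e ⟩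
    umbral 1# (- 1#) e n
  ≈⟨ [-1]ⁿQⁿ[-Qi+Qiξ]ⁿ≈[1-ξ]ⁿ qqi≈1 n e ⟨
    pow (- 1#) n * (pow q n * umbral (- qi) qi e n)
  ≈⟨ *-congˡ (*-congˡ (qEulerPoly-−1 q qi e n)) ⟨
    pow (- 1#) n * (pow q n * qEulerPoly q qi e n -[1+ 0 ])
  ∎
  where
  open CommutativeRing R
  open QEuler R
  open QEulerProperties R
  open import Relation.Binary.Reasoning.Setoid setoid

  regularᵢ : ∀ k → NonZeroDivisor (1# + pow qi (suc k))
  regularᵢ k = inverse-nonZeroDivisor (suc k) qqi≈1 (regular k)
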